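{- Let $\alpha=\sqrt2$, $A(n)=\lfloor n\alpha\rfloor$ for $n\ge1$, and $\Delta AA=(A(A(n+1))-A(A(n)))_{n\ge1}=1,3,2,2,2,1,3,1,3,2,\dots$. Let $\theta$ be the morphism on $\{a,b,c,d\}$ given by $\theta(a)=adc$, $\theta(b)=adc$, $\theta(c)=ad$, $\theta(d)=bc$, and $\lambda$ the letter-to-letter map $a\mapsto1$, $b\mapsto2$, $c\mapsto2$, $d\mapsto3$. Then $\Delta AA=\lambda(\theta^{\infty}(a))$.
   Context: $\theta^{\infty}(a)$ denotes the infinite fixed point of $\theta$ starting with $a$, i.e. the limit of $\theta^n(a)$; $\lambda$ is applied letterwise. -}

module Defs where

open import Data.Nat using (ℕ; zero; suc; _+_; _*_; _∸_; _≤?_)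
open import Data.List using (List; []; _∷_; concatMap; length; lookup)
open import Data.Bool using (if_then_else_)
open import Relation.Nullary.Decidable using (⌊_⌋)
open import Function using (_∘_)

isqrtAux : ℕ → ℕ → ℕ
isqrtAux N zero    = zero
isqrtAux N (suc m) = if ⌊ suc m * suc m ≤? N ⌋ then suc m else isqrtAux N m

isqrt : ℕ → ℕ
isqrt N = isqrtAux N N

-- A(n) = floor (n * sqrt 2) = floor (sqrt (2 n^2))
A : ℕ → ℕ
A n = isqrt (2 * (n * n))

-- ΔAA(n) = A(A(n+1)) - A(A(n))   (A ∘ A is increasing, so ∸ is exact)
ΔAA : ℕ → ℕ
ΔAA n = A (A (suc n)) ∸ A (A n)

data Letter : Set where
  a b c d : Letter

θ : Letter → List Letter
θ a = a ∷ d ∷ c ∷ []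
θ b = a ∷ d ∷ c ∷ []
θ c = a ∷ d ∷ []
θ d = b ∷ c ∷ []

θ* : List Letter → List Letter
θ* = concatMap θ

θ^ : ℕ → List Letter
θ^ zero    = a ∷ []
θ^ (suc m) = θ* (θ^ m)

λ' : Letter → ℕ
λ' a = 1
λ' b = 2
λ' c = 2
λ' d = 3

-- Write x n = 2{n√2} = 2(n√2 − A n) ∈ [0, 2).  Passing from n to n + 1 rotates x n by 2√2
-- modulo 2, and A (A n) = 2n − 2 + [x n < √2], so ΔAA n is read off x n and x (n + 1).
-- Cutting (0, 2) at 6 − 4√2, 2 − √2, 4 − 2√2, 6 − 3√2 into five intervals labelled
-- a, b, d, c, a, the label of x n has λ-value ΔAA (n + 1).  The labelling is a fixed point
-- of θ because of a self-similarity of the rotation: at position n + A n + [x n > 2 − √2]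
-- the value is (1 − √2) x n plus a constant, and the next few rotations of that value
-- spell out θ of the label of x n.  All comparisons are done exactly in ℤ[√2] ⊂ ℝ,
-- where p + q√2 > 0 is decided by comparing p² with 2q², using that √2 is irrational.

module Submission where

open import Defs
open import Data.Bool using (if_then_else_)
open import Data.Product using (Σ; _×_; _,_; uncurry)
open import Data.Sum using (_⊎_; inj₁; inj₂; [_,_]′)
open import Function using (id; _∘_; _⇔_; mk⇔; Equivalence)
open import Function.Properties.Equivalence using () renaming (trans to ⇔-trans)
open import Relation.Nullary using (¬_; Dec; does; yes; no; contradiction; _×-dec_; _⊎-dec_; map′)
open import Relation.Nullary.Decidable using (True; toWitness; dec-true; dec-false)
open import Relation.Binary.Definitions using (Decidable; DecidableEquality; tri<; tri≈; tri>)
open import Relation.Binary.PropositionalEquality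

-- Squares and integer square roots in ℕ

module _ where
  open import Data.Nat using (ℕ; zero; suc; _+_; _*_; _≤_; _<_; z≤n; z<s; _≤?_)
  open import Data.Nat.Properties
  open import Data.Nat.Divisibility using (divides)
  open import Data.Nat.Primality using (euclidsLemma; prime[2])
  open import Data.Nat.Induction using (<-rec)
  open import Data.Nat.Tactic.RingSolver using (solve-∀)

  *-self-cancel-≤ : ∀ {m n} → m * m ≤ n * n → m ≤ n
  *-self-cancel-≤ m²≤n² = ≮⇒≥ λ n<m → <⇒≱ (*-mono-< n<m n<m) m²≤n²

  *-self-cancel-< : ∀ {m n} → m * m < n * n → m < n
  *-self-cancel-< m²<n² = ≰⇒> λ n≤m → <⇒≱ m²<n² (*-mono-≤ n≤m n≤m)

  double-sq : ∀ m → 2 * m * (2 * m) ≡ 2 * (2 * (m * m))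
  double-sq = solve-∀

  -- Descent: from m² = 2n² with n > 0, m = 2k and n² = 2k² is a smaller solution.
  √2-irrational : ∀ m n → m * m ≡ 2 * (n * n) → n ≡ 0
  √2-irrational = <-rec _ descent
    where
    descent : ∀ m → (∀ {m′} → m′ < m → ∀ n → m′ * m′ ≡ 2 * (n * n) → n ≡ 0) →
              ∀ n → m * m ≡ 2 * (n * n) → n ≡ 0
    descent m rec zero    _  = refl
    descent m rec (suc n) eq
      with [ id , id ]′ (euclidsLemma m m prime[2] (divides (suc n * suc n) (trans eq (*-comm 2 (suc n * suc n)))))
    ... | divides k refl = contradiction (trans n²≡2k² (cong (λ k → 2 * (k * k)) k≡0)) λ ()
      where
      n²≡2k² : suc n * suc n ≡ 2 * (k * k)
      n²≡2k² = *-cancelˡ-≡ _ _ 2 (trans (sym eq) (trans (cong (λ i → i * i) (*-comm k 2)) (double-sq k)))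
      n<m : suc n < k * 2
      n<m = *-self-cancel-< (subst (suc n * suc n <_) (sym eq) (m<m+n (suc n * suc n) z<s))
      k≡0 : k ≡ 0
      k≡0 = rec n<m k n²≡2k²

  sq-mono : ∀ {m n} → m ≤ n → m * m ≤ n * n
  sq-mono m≤n = *-mono-≤ m≤n m≤n

  cross-term : ∀ k l u v s t → k * (u * u) ≤ l * (s * s) → k * (v * v) ≤ l * (t * t) →
               k * (u * v) ≤ l * (s * t)
  cross-term k l u v s t ku²≤ls² kv²≤lt² = *-self-cancel-≤ (begin
    k * (u * v) * (k * (u * v))     ≡⟨ regroup k u v ⟩
    k * (u * u) * (k * (v * v))     ≤⟨ *-mono-≤ ku²≤ls² kv²≤lt² ⟩
    l * (s * s) * (l * (t * t))     ≡⟨ regroup l s t ⟨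
    l * (s * t) * (l * (s * t))     ∎)
    where
    open ≤-Reasoning
    regroup : ∀ k u v → k * (u * v) * (k * (u * v)) ≡ k * (u * u) * (k * (v * v))
    regroup = solve-∀

  weighted-triangle : ∀ k l u v s t → k * (u * u) < l * (s * s) → k * (v * v) ≤ l * (t * t) →
                      k * ((u + v) * (u + v)) < l * ((s + t) * (s + t))
  weighted-triangle k l u v s t ku²<ls² kv²≤lt² = begin-strict
    k * ((u + v) * (u + v))                           ≡⟨ expand k u v ⟩
    k * (u * u) + 2 * (k * (u * v)) + k * (v * v)     <⟨ +-mono-<-≤ (+-mono-<-≤ ku²<ls² cross) kv²≤lt² ⟩
    l * (s * s) + 2 * (l * (s * t)) + l * (t * t)     ≡⟨ expand l s t ⟨
    l * ((s + t) * (s + t))                           ∎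
    where
    open ≤-Reasoning
    expand : ∀ k u v → k * ((u + v) * (u + v)) ≡ k * (u * u) + 2 * (k * (u * v)) + k * (v * v)
    expand = solve-∀
    cross = *-monoʳ-≤ 2 (cross-term k l u v s t (<⇒≤ ku²<ls²) kv²≤lt²)

  sum-sq : ∀ m → (m + m) * (m + m) ≡ 4 * (m * m)
  sum-sq = solve-∀

  *-4-<⇔ : ∀ {m n} → 4 * m < 4 * n ⇔ m < n
  *-4-<⇔ {m} {n} = mk⇔ (*-cancelˡ-< 4 m n) (*-monoʳ-< 4)

  scale-sq-<⇔ : ∀ k {m n} → (m + m) * (m + m) < k * ((n + n) * (n + n)) ⇔ m * m < k * (n * n)
  scale-sq-<⇔ k {m} {n} = subst₂ (λ u v → u < v ⇔ m * m < k * (n * n)) (sym (sum-sq m)) (sym (k-sum-sq k n)) *-4-<⇔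
    where
    k-sum-sq : ∀ k n → k * ((n + n) * (n + n)) ≡ 4 * (k * (n * n))
    k-sum-sq = solve-∀

  scale-sq->⇔ : ∀ k {m n} → k * ((n + n) * (n + n)) < (m + m) * (m + m) ⇔ k * (n * n) < m * m
  scale-sq->⇔ k {m} {n} = subst₂ (λ u v → u < v ⇔ k * (n * n) < m * m) (sym (k-sum-sq k n)) (sym (sum-sq m)) *-4-<⇔
    where
    k-sum-sq : ∀ k n → k * ((n + n) * (n + n)) ≡ 4 * (k * (n * n))
    k-sum-sq = solve-∀

  isqrtAux-sq≤ : ∀ N m → isqrtAux N m * isqrtAux N m ≤ N
  isqrtAux-sq≤ N zero    = z≤n
  isqrtAux-sq≤ N (suc m) with suc m * suc m ≤? N
  ... | yes m²≤N = m²≤N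
  ... | no  _    = isqrtAux-sq≤ N m

  isqrtAux-<-suc-sq : ∀ N m → N < suc m * suc m → N < suc (isqrtAux N m) * suc (isqrtAux N m)
  isqrtAux-<-suc-sq N zero    N<1 = N<1
  isqrtAux-<-suc-sq N (suc m) N<m² with suc m * suc m ≤? N
  ... | yes _   = N<m²
  ... | no  m²≰N = isqrtAux-<-suc-sq N m (≰⇒> m²≰N)

  isqrt-sq≤ : ∀ N → isqrt N * isqrt N ≤ N
  isqrt-sq≤ N = isqrtAux-sq≤ N N

  <-isqrt-suc-sq : ∀ N → N < suc (isqrt N) * suc (isqrt N)
  <-isqrt-suc-sq N = isqrtAux-<-suc-sq N N (<-≤-trans (n<1+n N) (m≤m*n (suc N) (suc N)))

  isqrt-unique : ∀ {N y} → y * y ≤ N → N < suc y * suc y → isqrt N ≡ y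
  isqrt-unique {N} {y} y²≤N N<[y+1]² with <-cmp (isqrt N) y
  ... | tri≈ _ r≡y _ = r≡y
  ... | tri< r<y _ _ = contradiction (≤-trans (*-mono-≤ r<y r<y) y²≤N) (<⇒≱ (<-isqrt-suc-sq N))
  ... | tri> _ _ y<r = contradiction (≤-trans (*-mono-≤ y<r y<r) (isqrt-sq≤ N)) (<⇒≱ N<[y+1]²)

-- The ordered group ℤ[√2]

module _ where
  open import Data.Integer using (ℤ; +_; -_; -[1+_]; +[1+_]; +0; 0ℤ; ∣_∣; _+_; _-_; _*_; _<_; +<+)
  open import Data.Integer.Properties
    using (∣-i∣≡∣i∣; ∣i∣≡0⇒i≡0; ∣i+j∣≤∣i∣+∣j∣; abs-*; <-irrefl; _<?_; +-mono-<; *-monoˡ-<-pos;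
           +-comm; +-identityˡ; +-identityʳ; +-inverseʳ; neg-involutive)
    renaming (_≟_ to _≟ℤ_)
  open import Data.Integer.Tactic.RingSolver using (solve-∀)
  import Data.Nat as ℕ
  import Data.Nat.Properties as ℕₚ

  -- ⟨ p , q ⟩ stands for p + q√2
  record ℤ[√2] : Set where
    constructor ⟨_,_⟩
    field
      rat irr : ℤ
  open ℤ[√2]

  infixl 6 _⊕_ _⊖_
  infix  8 ⊖_ √2·_ ρ·_
  infix  4 _≟_

  _⊕_ : ℤ[√2] → ℤ[√2] → ℤ[√2]
  ⟨ p , q ⟩ ⊕ ⟨ r , s ⟩ = ⟨ p + r , q + s ⟩

  ⊖_ : ℤ[√2] → ℤ[√2]
  ⊖ ⟨ p , q ⟩ = ⟨ - p , - q ⟩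

  _⊖_ : ℤ[√2] → ℤ[√2] → ℤ[√2]
  x ⊖ y = x ⊕ ⊖ y

  √2·_ : ℤ[√2] → ℤ[√2]
  √2· ⟨ p , q ⟩ = ⟨ + 2 * q , p ⟩

  -- multiplication by ρ = 1 − √2
  ρ·_ : ℤ[√2] → ℤ[√2]
  ρ· ⟨ p , q ⟩ = ⟨ p - + 2 * q , q - p ⟩

  0# two : ℤ[√2]
  0# = ⟨ 0ℤ , 0ℤ ⟩
  two = ⟨ + 2 , 0ℤ ⟩

  _≟_ : DecidableEquality ℤ[√2]
  ⟨ p , q ⟩ ≟ ⟨ r , s ⟩ =
    map′ (λ (p≡r , q≡s) → cong₂ ⟨_,_⟩ p≡r q≡s) (λ x≡y → cong rat x≡y , cong irr x≡y) (p ≟ℤ r ×-dec q ≟ℤ s)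

  ratSq irrSq : ℤ[√2] → ℕ.ℕ
  ratSq x = ∣ rat x ∣ ℕ.* ∣ rat x ∣
  irrSq x = 2 ℕ.* (∣ irr x ∣ ℕ.* ∣ irr x ∣)

  RatDominant IrrDominant : ℤ[√2] → Set
  RatDominant x = irrSq x ℕ.< ratSq x
  IrrDominant x = ratSq x ℕ.< irrSq x

  -- p + q√2 > 0 holds iff one of p, q√2 is positive and exceeds the other in absolute value
  data Positive (x : ℤ[√2]) : Set where
    rat-dominant : 0ℤ < rat x → RatDominant x → Positive x
    irr-dominant : 0ℤ < irr x → IrrDominant x → Positive x

  positive? : ∀ x → Dec (Positive x)
  positive? x = map′ [ uncurry rat-dominant , uncurry irr-dominant ]′ split
    ((0ℤ <? rat x ×-dec irrSq x ℕₚ.<? ratSq x) ⊎-dec (0ℤ <? irr x ×-dec ratSq x ℕₚ.<? irrSq x))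
    where
    split : Positive x → (0ℤ < rat x × RatDominant x) ⊎ (0ℤ < irr x × IrrDominant x)
    split (rat-dominant p>0 dom) = inj₁ (p>0 , dom)
    split (irr-dominant q>0 dom) = inj₂ (q>0 , dom)

  ¬positive-0# : ¬ Positive 0#
  ¬positive-0# (rat-dominant (+<+ ()) _)
  ¬positive-0# (irr-dominant (+<+ ()) _)

  ratSq-⊖ : ∀ x → ratSq (⊖ x) ≡ ratSq x
  ratSq-⊖ ⟨ p , _ ⟩ rewrite ∣-i∣≡∣i∣ p = refl

  irrSq-⊖ : ∀ x → irrSq (⊖ x) ≡ irrSq x
  irrSq-⊖ ⟨ _ , q ⟩ rewrite ∣-i∣≡∣i∣ q = refl

  ratDominant-⊖ : ∀ x → RatDominant (⊖ x) ⇔ RatDominant x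
  ratDominant-⊖ x = mk⇔ (subst₂ ℕ._<_ (irrSq-⊖ x) (ratSq-⊖ x)) (subst₂ ℕ._<_ (sym (irrSq-⊖ x)) (sym (ratSq-⊖ x)))

  irrDominant-⊖ : ∀ x → IrrDominant (⊖ x) ⇔ IrrDominant x
  irrDominant-⊖ x = mk⇔ (subst₂ ℕ._<_ (ratSq-⊖ x) (irrSq-⊖ x)) (subst₂ ℕ._<_ (sym (ratSq-⊖ x)) (sym (irrSq-⊖ x)))

  ∣+∣-pos : ∀ {i j} → 0ℤ < i → 0ℤ < j → ∣ i + j ∣ ≡ ∣ i ∣ ℕ.+ ∣ j ∣
  ∣+∣-pos (+<+ _) (+<+ _) = refl

  ratDominant-⊕ : ∀ x y → 0ℤ < rat x → 0ℤ < rat y → RatDominant x → RatDominant y → RatDominant (x ⊕ y)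
  ratDominant-⊕ ⟨ p , q ⟩ ⟨ r , s ⟩ p>0 r>0 x-dom y-dom = begin-strict
    2 ℕ.* (∣ q + s ∣ ℕ.* ∣ q + s ∣)                       ≤⟨ ℕₚ.*-monoʳ-≤ 2 (sq-mono (∣i+j∣≤∣i∣+∣j∣ q s)) ⟩
    2 ℕ.* ((∣ q ∣ ℕ.+ ∣ s ∣) ℕ.* (∣ q ∣ ℕ.+ ∣ s ∣))
      <⟨ weighted-triangle 2 1 (∣ q ∣) (∣ s ∣) (∣ p ∣) (∣ r ∣) (one x-dom) (ℕₚ.<⇒≤ (one y-dom)) ⟩
    1 ℕ.* ((∣ p ∣ ℕ.+ ∣ r ∣) ℕ.* (∣ p ∣ ℕ.+ ∣ r ∣))        ≡⟨ ℕₚ.*-identityˡ _ ⟩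
    (∣ p ∣ ℕ.+ ∣ r ∣) ℕ.* (∣ p ∣ ℕ.+ ∣ r ∣)               ≡⟨ cong (λ n → n ℕ.* n) (∣+∣-pos p>0 r>0) ⟨
    ∣ p + r ∣ ℕ.* ∣ p + r ∣                               ∎
    where
    open ℕₚ.≤-Reasoning
    one : ∀ {m n} → m ℕ.< n → m ℕ.< 1 ℕ.* n
    one {n = n} = subst (_ ℕ.<_) (sym (ℕₚ.*-identityˡ n))

  irrDominant-⊕ : ∀ x y → 0ℤ < irr x → 0ℤ < irr y → IrrDominant x → IrrDominant y → IrrDominant (x ⊕ y)
  irrDominant-⊕ ⟨ p , q ⟩ ⟨ r , s ⟩ q>0 s>0 x-dom y-dom = begin-strict
    ∣ p + r ∣ ℕ.* ∣ p + r ∣                               ≤⟨ sq-mono (∣i+j∣≤∣i∣+∣j∣ p r) ⟩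
    (∣ p ∣ ℕ.+ ∣ r ∣) ℕ.* (∣ p ∣ ℕ.+ ∣ r ∣)               ≡⟨ ℕₚ.*-identityˡ _ ⟨
    1 ℕ.* ((∣ p ∣ ℕ.+ ∣ r ∣) ℕ.* (∣ p ∣ ℕ.+ ∣ r ∣))
      <⟨ weighted-triangle 1 2 (∣ p ∣) (∣ r ∣) (∣ q ∣) (∣ s ∣) (one x-dom) (ℕₚ.<⇒≤ (one y-dom)) ⟩
    2 ℕ.* ((∣ q ∣ ℕ.+ ∣ s ∣) ℕ.* (∣ q ∣ ℕ.+ ∣ s ∣))        ≡⟨ cong (λ n → 2 ℕ.* (n ℕ.* n)) (∣+∣-pos q>0 s>0) ⟨
    2 ℕ.* (∣ q + s ∣ ℕ.* ∣ q + s ∣)                       ∎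
    where
    open ℕₚ.≤-Reasoning
    one : ∀ {m n} → m ℕ.< n → 1 ℕ.* m ℕ.< n
    one {m} = subst (ℕ._< _) (sym (ℕₚ.*-identityˡ m))

  ratDominant⇒rat≢0 : ∀ {x} → RatDominant x → rat x ≢ 0ℤ
  ratDominant⇒rat≢0 {⟨ _ , _ ⟩} dom refl = ℕₚ.n≮0 dom

  irrDominant⇒irr≢0 : ∀ {x} → IrrDominant x → irr x ≢ 0ℤ
  irrDominant⇒irr≢0 {⟨ _ , _ ⟩} dom refl = ℕₚ.n≮0 dom

  dominance : ∀ {x} → x ≢ 0# → RatDominant x ⊎ IrrDominant x
  dominance {x@(⟨ p , q ⟩)} x≢0 with ℕₚ.<-cmp (ratSq x) (irrSq x)
  ... | tri< rat<irr _ _ = inj₂ rat<irr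
  ... | tri> _ _ irr<rat = inj₁ irr<rat
  ... | tri≈ _ rat≡irr _ = contradiction (cong₂ ⟨_,_⟩ (∣i∣≡0⇒i≡0 p≡0) (∣i∣≡0⇒i≡0 q≡0)) x≢0
    where
    q≡0 = √2-irrational ∣ p ∣ ∣ q ∣ rat≡irr
    p≡0 = [ id , id ]′ (ℕₚ.m*n≡0⇒m≡0∨n≡0 ∣ p ∣ (subst (λ n → ratSq x ≡ 2 ℕ.* (n ℕ.* n)) q≡0 rat≡irr))

  sign-split : ∀ {i} → i ≢ 0ℤ → 0ℤ < i ⊎ 0ℤ < - i
  sign-split {+0}       i≢0 = contradiction refl i≢0
  sign-split {+[1+ _ ]} _   = inj₁ (+<+ ℕ.z<s)
  sign-split { -[1+ _ ]} _  = inj₂ (+<+ ℕ.z<s)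

  positive-or-negative : ∀ {x} → x ≢ 0# → Positive x ⊎ Positive (⊖ x)
  positive-or-negative {x} x≢0 with dominance x≢0
  ... | inj₁ dom with sign-split (ratDominant⇒rat≢0 {x} dom)
  ...   | inj₁ p>0  = inj₁ (rat-dominant p>0 dom)
  ...   | inj₂ -p>0 = inj₂ (rat-dominant -p>0 (Equivalence.from (ratDominant-⊖ x) dom))
  positive-or-negative {x} x≢0 | inj₂ dom with sign-split (irrDominant⇒irr≢0 {x} dom)
  ...   | inj₁ q>0  = inj₁ (irr-dominant q>0 dom)
  ...   | inj₂ -q>0 = inj₂ (irr-dominant -q>0 (Equivalence.from (irrDominant-⊖ x) dom))

  ⊕-comm : ∀ x y → x ⊕ y ≡ y ⊕ x
  ⊕-comm ⟨ p , q ⟩ ⟨ r , s ⟩ = cong₂ ⟨_,_⟩ (+-comm p r) (+-comm q s)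

  ⊕-identityʳ : ∀ x → x ⊕ 0# ≡ x
  ⊕-identityʳ ⟨ p , q ⟩ = cong₂ ⟨_,_⟩ (+-identityʳ p) (+-identityʳ q)

  ⊖-involutive : ∀ x → ⊖ ⊖ x ≡ x
  ⊖-involutive ⟨ p , q ⟩ = cong₂ ⟨_,_⟩ (neg-involutive p) (neg-involutive q)

  ⊖-⊕-cancelˡ : ∀ x y → ⊖ x ⊕ (x ⊕ y) ≡ y
  ⊖-⊕-cancelˡ ⟨ p , q ⟩ ⟨ r , s ⟩ = cong₂ ⟨_,_⟩ (cancel p r) (cancel q s)
    where
    cancel : ∀ i j → - i + (i + j) ≡ j
    cancel = solve-∀

  ⊖-⊕-cancelʳ : ∀ x y → ⊖ (x ⊕ y) ⊕ y ≡ ⊖ x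
  ⊖-⊕-cancelʳ ⟨ p , q ⟩ ⟨ r , s ⟩ = cong₂ ⟨_,_⟩ (cancel p r) (cancel q s)
    where
    cancel : ∀ i j → - (i + j) + j ≡ - i
    cancel = solve-∀

  ⊕-⊖-cancelʳ : ∀ x y → x ⊕ ⊖ (x ⊕ y) ≡ ⊖ y
  ⊕-⊖-cancelʳ ⟨ p , q ⟩ ⟨ r , s ⟩ = cong₂ ⟨_,_⟩ (cancel p r) (cancel q s)
    where
    cancel : ∀ i j → i + - (i + j) ≡ - j
    cancel = solve-∀

  ⊕≡0⇒≡⊖ : ∀ {x y} → x ⊕ y ≡ 0# → y ≡ ⊖ x
  ⊕≡0⇒≡⊖ {x} {y} x+y≡0 = begin
    y                ≡⟨ ⊖-⊕-cancelˡ x y ⟨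
    ⊖ x ⊕ (x ⊕ y)    ≡⟨ cong (⊖ x ⊕_) x+y≡0 ⟩
    ⊖ x ⊕ 0#         ≡⟨ ⊕-identityʳ (⊖ x) ⟩
    ⊖ x              ∎
    where open ≡-Reasoning

  -- If x + y were not positive, subtracting it from the summand with the same
  -- kind of dominance would transfer that dominance to the other summand.
  ⊕-positive-mixed : ∀ x y → 0ℤ < rat x → RatDominant x → 0ℤ < irr y → IrrDominant y → Positive (x ⊕ y)
  ⊕-positive-mixed x y p>0 x-dom s>0 y-dom with x ⊕ y ≟ 0#
  ... | yes x+y≡0 =
    contradiction (Equivalence.to (irrDominant-⊖ x) (subst IrrDominant (⊕≡0⇒≡⊖ {x} {y} x+y≡0) y-dom)) (ℕₚ.<-asym x-dom)
  ... | no x+y≢0 with positive-or-negative {x ⊕ y} x+y≢0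
  ...   | inj₁ x+y⁺ = x+y⁺
  ...   | inj₂ (rat-dominant r>0 dom) = contradiction
    (Equivalence.to (ratDominant-⊖ y)
      (subst RatDominant (⊕-⊖-cancelʳ x y) (ratDominant-⊕ x (⊖ (x ⊕ y)) p>0 r>0 x-dom dom)))
    (ℕₚ.<-asym y-dom)
  ...   | inj₂ (irr-dominant q>0 dom) = contradiction
    (Equivalence.to (irrDominant-⊖ x)
      (subst IrrDominant (⊖-⊕-cancelʳ x y) (irrDominant-⊕ (⊖ (x ⊕ y)) y q>0 s>0 dom y-dom)))
    (ℕₚ.<-asym x-dom)

  ⊕-positive : ∀ {x y} → Positive x → Positive y → Positive (x ⊕ y)
  ⊕-positive {x} {y} (rat-dominant p>0 x-dom) (rat-dominant r>0 y-dom) =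
    rat-dominant (+-mono-< p>0 r>0) (ratDominant-⊕ x y p>0 r>0 x-dom y-dom)
  ⊕-positive {x} {y} (irr-dominant q>0 x-dom) (irr-dominant s>0 y-dom) =
    irr-dominant (+-mono-< q>0 s>0) (irrDominant-⊕ x y q>0 s>0 x-dom y-dom)
  ⊕-positive {x} {y} (rat-dominant p>0 x-dom) (irr-dominant s>0 y-dom) =
    ⊕-positive-mixed x y p>0 x-dom s>0 y-dom
  ⊕-positive {x} {y} (irr-dominant q>0 x-dom) (rat-dominant r>0 y-dom) =
    subst Positive (⊕-comm y x) (⊕-positive-mixed y x r>0 y-dom q>0 x-dom)

  ⊕-inverseʳ : ∀ x → x ⊖ x ≡ 0#
  ⊕-inverseʳ ⟨ p , q ⟩ = cong₂ ⟨_,_⟩ (+-inverseʳ p) (+-inverseʳ q)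

  positive-asym : ∀ {x} → Positive x → ¬ Positive (⊖ x)
  positive-asym {x} x⁺ -x⁺ = ¬positive-0# (subst Positive (⊕-inverseʳ x) (⊕-positive x⁺ -x⁺))

  √2·-positive : ∀ {x} → Positive x → Positive (√2· x)
  √2·-positive {⟨ p , q ⟩} (rat-dominant p>0 dom) = irr-dominant p>0 (begin-strict
    ∣ + 2 * q ∣ ℕ.* ∣ + 2 * q ∣     ≡⟨ cong (λ n → n ℕ.* n) (abs-* (+ 2) q) ⟩
    2 ℕ.* ∣ q ∣ ℕ.* (2 ℕ.* ∣ q ∣)   ≡⟨ double-sq ∣ q ∣ ⟩
    2 ℕ.* (2 ℕ.* (∣ q ∣ ℕ.* ∣ q ∣)) <⟨ ℕₚ.*-monoʳ-< 2 dom ⟩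
    2 ℕ.* (∣ p ∣ ℕ.* ∣ p ∣)         ∎)
    where open ℕₚ.≤-Reasoning
  √2·-positive {⟨ p , q ⟩} (irr-dominant q>0 dom) = rat-dominant (*-monoˡ-<-pos (+ 2) q>0) (begin-strict
    2 ℕ.* (∣ p ∣ ℕ.* ∣ p ∣)         <⟨ ℕₚ.*-monoʳ-< 2 dom ⟩
    2 ℕ.* (2 ℕ.* (∣ q ∣ ℕ.* ∣ q ∣)) ≡⟨ double-sq ∣ q ∣ ⟨
    2 ℕ.* ∣ q ∣ ℕ.* (2 ℕ.* ∣ q ∣)   ≡⟨ cong (λ n → n ℕ.* n) (abs-* (+ 2) q) ⟨
    ∣ + 2 * q ∣ ℕ.* ∣ + 2 * q ∣     ∎)
    where open ℕₚ.≤-Reasoning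

  √2·ρ·-identity : ∀ x → √2· (ρ· x) ⊕ ρ· x ≡ ⊖ x
  √2·ρ·-identity ⟨ p , q ⟩ = cong₂ ⟨_,_⟩ (rat-part p q) (irr-part p q)
    where
    rat-part : ∀ p q → + 2 * (q - p) + (p - + 2 * q) ≡ - p
    rat-part = solve-∀
    irr-part : ∀ p q → (p - + 2 * q) + (q - p) ≡ - q
    irr-part = solve-∀

  -- ρ = 1 − √2 is negative: were ρx positive, so would be (√2 + 1)ρx = −x.
  ρ·-negative : ∀ {x} → Positive x → Positive (⊖ ρ· x)
  ρ·-negative {x} x⁺ with ρ· x ≟ 0#
  ... | yes ρx≡0 = contradiction (subst Positive x≡0 x⁺) ¬positive-0#
    where
    x≡0 : x ≡ 0#
    x≡0 = begin
      x                    ≡⟨ ⊖-involutive x ⟨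
      ⊖ ⊖ x                ≡⟨ cong ⊖_ (√2·ρ·-identity x) ⟨
      ⊖ (√2· (ρ· x) ⊕ ρ· x) ≡⟨ cong (λ y → ⊖ (√2· y ⊕ y)) ρx≡0 ⟩
      0#                   ∎
      where open ≡-Reasoning
  ... | no ρx≢0 with positive-or-negative {ρ· x} ρx≢0
  ...   | inj₂ -ρx⁺ = -ρx⁺
  ...   | inj₁ ρx⁺  =
    contradiction (subst Positive (√2·ρ·-identity x) (⊕-positive (√2·-positive ρx⁺) ρx⁺)) (positive-asym x⁺)

  infix 4 _≺_ _≼_ _≺?_ _≼?_

  record _≺_ (x y : ℤ[√2]) : Set where
    constructor mk≺
    field difference-positive : Positive (y ⊖ x)
  open _≺_

  _≺?_ : Decidable _≺_
  x ≺? y = map′ mk≺ difference-positive (positive? (y ⊖ x))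

  _≼_ : ℤ[√2] → ℤ[√2] → Set
  x ≼ y = x ≺ y ⊎ x ≡ y

  _≼?_ : Decidable _≼_
  x ≼? y = x ≺? y ⊎-dec x ≟ y

  0≺⇔positive : ∀ {x} → 0# ≺ x ⇔ Positive x
  0≺⇔positive {x} =
    mk⇔ (subst Positive (⊕-identityʳ x) ∘ difference-positive) (mk≺ ∘ subst Positive (sym (⊕-identityʳ x)))

  ≺-trans : ∀ {x y z} → x ≺ y → y ≺ z → x ≺ z
  ≺-trans {⟨ p , q ⟩} {⟨ r , s ⟩} {⟨ t , u ⟩} (mk≺ y-x⁺) (mk≺ z-y⁺) =
    mk≺ (subst Positive (cong₂ ⟨_,_⟩ (telescope p r t) (telescope q s u)) (⊕-positive z-y⁺ y-x⁺))
    where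
    telescope : ∀ i j k → (k + - j) + (j + - i) ≡ k + - i
    telescope = solve-∀

  ≺-irrefl : ∀ {x} → ¬ x ≺ x
  ≺-irrefl {x} (mk≺ x-x⁺) = ¬positive-0# (subst Positive (⊕-inverseʳ x) x-x⁺)

  ≺-asym : ∀ {x y} → x ≺ y → ¬ y ≺ x
  ≺-asym x≺y y≺x = ≺-irrefl (≺-trans x≺y y≺x)

  ≺-≼-trans : ∀ {x y z} → x ≺ y → y ≼ z → x ≺ z
  ≺-≼-trans x≺y (inj₁ y≺z) = ≺-trans x≺y y≺z
  ≺-≼-trans x≺y (inj₂ refl) = x≺y

  ≼-≺-trans : ∀ {x y z} → x ≼ y → y ≺ z → x ≺ z
  ≼-≺-trans (inj₁ x≺y) y≺z = ≺-trans x≺y y≺z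
  ≼-≺-trans (inj₂ refl) y≺z = y≺z

  ⊖-difference : ∀ x y → ⊖ (y ⊖ x) ≡ x ⊖ y
  ⊖-difference ⟨ p , q ⟩ ⟨ r , s ⟩ = cong₂ ⟨_,_⟩ (swap p r) (swap q s)
    where
    swap : ∀ i j → - (j + - i) ≡ i + - j
    swap = solve-∀

  ≺-connex : ∀ {x y} → x ≢ y → x ≺ y ⊎ y ≺ x
  ≺-connex {x} {y} x≢y with positive-or-negative {y ⊖ x} y-x≢0
    where
    y-x≢0 : y ⊖ x ≢ 0#
    y-x≢0 y-x≡0 = x≢y (trans (sym (⊖-involutive x)) (trans (cong ⊖_ (⊕≡0⇒≡⊖ {y} {⊖ x} y-x≡0)) (⊖-involutive y)))
  ... | inj₁ y-x⁺  = inj₁ (mk≺ y-x⁺)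
  ... | inj₂ x-y⁺  = inj₂ (mk≺ (subst Positive (⊖-difference x y) x-y⁺))

  ≺-split : ∀ {x y} → x ≢ y → ¬ x ≺ y → y ≺ x
  ≺-split x≢y x⊀y = [ (λ x≺y → contradiction x≺y x⊀y) , id ]′ (≺-connex x≢y)

  ⊕-monoˡ-≺ : ∀ {x y} z → x ≺ y → x ⊕ z ≺ y ⊕ z
  ⊕-monoˡ-≺ {⟨ p , q ⟩} {⟨ r , s ⟩} ⟨ t , u ⟩ (mk≺ y-x⁺) =
    mk≺ (subst Positive (cong₂ ⟨_,_⟩ (shift p r t) (shift q s u)) y-x⁺)
    where
    shift : ∀ i j k → j + - i ≡ (j + k) + - (i + k)
    shift = solve-∀

  ⊖-antitone : ∀ {x y} → x ≺ y → ⊖ y ≺ ⊖ x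
  ⊖-antitone {⟨ p , q ⟩} {⟨ r , s ⟩} (mk≺ y-x⁺) =
    mk≺ (subst Positive (cong₂ ⟨_,_⟩ (flip p r) (flip q s)) y-x⁺)
    where
    flip : ∀ i j → j + - i ≡ - i + - - j
    flip = solve-∀

  √2·-mono-≺ : ∀ {x y} → x ≺ y → √2· x ≺ √2· y
  √2·-mono-≺ {⟨ p , q ⟩} {⟨ r , s ⟩} (mk≺ y-x⁺) =
    mk≺ (subst Positive (cong₂ ⟨_,_⟩ (linear q s) refl) (√2·-positive y-x⁺))
    where
    linear : ∀ i j → + 2 * (j + - i) ≡ + 2 * j + - (+ 2 * i)
    linear = solve-∀

  ρ·-antitone : ∀ {x y} → x ≺ y → ρ· y ≺ ρ· x
  ρ·-antitone {⟨ p , q ⟩} {⟨ r , s ⟩} (mk≺ y-x⁺) =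
    mk≺ (subst Positive (cong₂ ⟨_,_⟩ (linear-rat p q r s) (linear-irr p q r s)) (ρ·-negative y-x⁺))
    where
    linear-rat : ∀ i j k l → - ((k + - i) - + 2 * (l + - j)) ≡ (i - + 2 * j) + - (k - + 2 * l)
    linear-rat = solve-∀
    linear-irr : ∀ i j k l → - ((l + - j) - (k + - i)) ≡ (j - i) + - (l - k)
    linear-irr = solve-∀

  infix 4 _∈⟨_,_⟩

  record _∈⟨_,_⟩ (x lo hi : ℤ[√2]) : Set where
    constructor _,_
    field
      lower : lo ≺ x
      upper : x ≺ hi
  open _∈⟨_,_⟩ public

  below : ∀ {x lo hi c} → x ∈⟨ lo , hi ⟩ → {_ : True (hi ≼? c)} → x ≺ c
  below x∈ {hi≼c} = ≺-≼-trans (upper x∈) (toWitness hi≼c)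

  above : ∀ {x lo hi c} → x ∈⟨ lo , hi ⟩ → {_ : True (c ≼? lo)} → c ≺ x
  above x∈ {c≼lo} = ≼-≺-trans (toWitness c≼lo) (lower x∈)

  not-below : ∀ {x lo hi c} → x ∈⟨ lo , hi ⟩ → {_ : True (c ≼? lo)} → ¬ x ≺ c
  not-below x∈ {c≼lo} = ≺-asym (above x∈ {c≼lo})

  widen : ∀ {x lo hi lo′ hi′} → x ∈⟨ lo , hi ⟩ → {_ : True (lo′ ≼? lo)} → {_ : True (hi ≼? hi′)} → x ∈⟨ lo′ , hi′ ⟩
  widen x∈ {lo′≼lo} {hi≼hi′} = above x∈ {lo′≼lo} , below x∈ {hi≼hi′}

  ⊕-∈ : ∀ {x lo hi} z → x ∈⟨ lo , hi ⟩ → x ⊕ z ∈⟨ lo ⊕ z , hi ⊕ z ⟩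
  ⊕-∈ z (lo≺x , x≺hi) = ⊕-monoˡ-≺ z lo≺x , ⊕-monoˡ-≺ z x≺hi

  ⊖-∈ : ∀ {x lo hi} → x ∈⟨ lo , hi ⟩ → ⊖ x ∈⟨ ⊖ hi , ⊖ lo ⟩
  ⊖-∈ (lo≺x , x≺hi) = ⊖-antitone x≺hi , ⊖-antitone lo≺x

  √2·-∈ : ∀ {x lo hi} → x ∈⟨ lo , hi ⟩ → √2· x ∈⟨ √2· lo , √2· hi ⟩
  √2·-∈ (lo≺x , x≺hi) = √2·-mono-≺ lo≺x , √2·-mono-≺ x≺hi

  ρ·-∈ : ∀ {x lo hi} → x ∈⟨ lo , hi ⟩ → ρ· x ∈⟨ ρ· hi , ρ· lo ⟩
  ρ·-∈ (lo≺x , x≺hi) = ρ·-antitone x≺hi , ρ·-antitone lo≺x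

  0≮-+ : ∀ n → ¬ 0ℤ < - + n
  0≮-+ ℕ.zero    = <-irrefl refl
  0≮-+ (ℕ.suc _) ()

  <n²⇒0<+n : ∀ {k n} → k ℕ.< n ℕ.* n → 0ℤ < + n
  <n²⇒0<+n {n = ℕ.zero}  k<0 = contradiction k<0 ℕₚ.n≮0
  <n²⇒0<+n {n = ℕ.suc _} _   = +<+ ℕ.z<s

  <2n²⇒0<+n : ∀ {k n} → k ℕ.< 2 ℕ.* (n ℕ.* n) → 0ℤ < + n
  <2n²⇒0<+n {n = ℕ.zero}  k<0 = contradiction k<0 ℕₚ.n≮0
  <2n²⇒0<+n {n = ℕ.suc _} _   = +<+ ℕ.z<s

  positive-⟨-,+⟩⇔ : ∀ {m n} → Positive ⟨ - + m , + n ⟩ ⇔ m ℕ.* m ℕ.< 2 ℕ.* (n ℕ.* n)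
  positive-⟨-,+⟩⇔ {m} {n} = mk⇔ to from
    where
    to : Positive ⟨ - + m , + n ⟩ → m ℕ.* m ℕ.< 2 ℕ.* (n ℕ.* n)
    to (rat-dominant -m>0 _) = contradiction -m>0 (0≮-+ m)
    to (irr-dominant _ dom)  = subst (λ k → k ℕ.* k ℕ.< _) (∣-i∣≡∣i∣ (+ m)) dom
    from : m ℕ.* m ℕ.< 2 ℕ.* (n ℕ.* n) → Positive ⟨ - + m , + n ⟩
    from m²<2n² = irr-dominant (<2n²⇒0<+n m²<2n²) (subst (λ k → k ℕ.* k ℕ.< _) (sym (∣-i∣≡∣i∣ (+ m))) m²<2n²)

  positive-⟨+,-⟩⇔ : ∀ {m n} → Positive ⟨ + m , - + n ⟩ ⇔ 2 ℕ.* (n ℕ.* n) ℕ.< m ℕ.* m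
  positive-⟨+,-⟩⇔ {m} {n} = mk⇔ to from
    where
    to : Positive ⟨ + m , - + n ⟩ → 2 ℕ.* (n ℕ.* n) ℕ.< m ℕ.* m
    to (rat-dominant _ dom)  = subst (λ k → 2 ℕ.* (k ℕ.* k) ℕ.< _) (∣-i∣≡∣i∣ (+ n)) dom
    to (irr-dominant -n>0 _) = contradiction -n>0 (0≮-+ n)
    from : 2 ℕ.* (n ℕ.* n) ℕ.< m ℕ.* m → Positive ⟨ + m , - + n ⟩
    from 2n²<m² = rat-dominant (<n²⇒0<+n 2n²<m²) (subst (λ k → 2 ℕ.* (k ℕ.* k) ℕ.< _) (sym (∣-i∣≡∣i∣ (+ n))) 2n²<m²)

  -- gap j y = 2(j√2 − y); opaque, so that j and y can be inferred from gap j y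
  opaque
    gap : ℕ.ℕ → ℕ.ℕ → ℤ[√2]
    gap j y = ⟨ - + (y ℕ.+ y) , + (j ℕ.+ j) ⟩

  opaque
    unfolding gap

    gap-def : ∀ j y → gap j y ≡ ⟨ - + (y ℕ.+ y) , + (j ℕ.+ j) ⟩
    gap-def j y = refl

    0≺gap⇔ : ∀ {j y} → 0# ≺ gap j y ⇔ y ℕ.* y ℕ.< 2 ℕ.* (j ℕ.* j)
    0≺gap⇔ {j} {y} = ⇔-trans 0≺⇔positive (⇔-trans positive-⟨-,+⟩⇔ (scale-sq-<⇔ 2 {y} {j}))

    gap≺two⇔ : ∀ {j y} → gap j y ≺ two ⇔ 2 ℕ.* (j ℕ.* j) ℕ.< ℕ.suc y ℕ.* ℕ.suc y
    gap≺two⇔ {j} {y} = ⇔-trans (mk⇔ (subst Positive two-gap ∘ difference-positive) (mk≺ ∘ subst Positive (sym two-gap)))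
                               (⇔-trans positive-⟨+,-⟩⇔ (scale-sq->⇔ 2 {ℕ.suc y} {j}))
      where
      two-gap : two ⊖ gap j y ≡ ⟨ + (ℕ.suc y ℕ.+ ℕ.suc y) , - + (j ℕ.+ j) ⟩
      two-gap = cong₂ ⟨_,_⟩ (rat-part (+ y)) (+-identityˡ _)
        where
        rat-part : ∀ Y → + 2 + - - (Y + Y) ≡ (+ 1 + Y) + (+ 1 + Y)
        rat-part = solve-∀

    gap-suc : ∀ j y δ → gap (ℕ.suc j) (y ℕ.+ δ) ≡ gap j y ⊕ ⟨ - + (δ ℕ.+ δ) , + 2 ⟩
    gap-suc j y δ = cong₂ ⟨_,_⟩ (rat-part (+ y) (+ δ)) (irr-part (+ j))
      where
      rat-part : ∀ Y D → - ((Y + D) + (Y + D)) ≡ - (Y + Y) + - (D + D)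
      rat-part = solve-∀
      irr-part : ∀ J → (+ 1 + J) + (+ 1 + J) ≡ (J + J) + + 2
      irr-part = solve-∀

    gap-renormalise₀ : ∀ n y → gap (ℕ.suc n ℕ.+ y ℕ.+ 0) (n ℕ.+ ℕ.suc n ℕ.+ y) ≡ ρ· gap (ℕ.suc n) y ⊕ two
    gap-renormalise₀ n y = cong₂ ⟨_,_⟩ (rat-part (+ n) (+ y)) (irr-part (+ n) (+ y))
      where
      rat-part : ∀ N Y → - (((N + (+ 1 + N)) + Y) + ((N + (+ 1 + N)) + Y))
                         ≡ (- (Y + Y) - + 2 * ((+ 1 + N) + (+ 1 + N))) + + 2
      rat-part = solve-∀
      irr-part : ∀ N Y → ((+ 1 + N) + Y + 0ℤ) + ((+ 1 + N) + Y + 0ℤ)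
                         ≡ (((+ 1 + N) + (+ 1 + N)) - - (Y + Y)) + 0ℤ
      irr-part = solve-∀

    gap-renormalise₁ : ∀ m y → gap (m ℕ.+ y ℕ.+ 1) (m ℕ.+ m ℕ.+ y ℕ.+ 1) ≡ ρ· gap m y ⊕ ⟨ - + 2 , + 2 ⟩
    gap-renormalise₁ m y = cong₂ ⟨_,_⟩ (rat-part (+ m) (+ y)) (irr-part (+ m) (+ y))
      where
      rat-part : ∀ M Y → - (((M + M) + Y + + 1) + ((M + M) + Y + + 1)) ≡ (- (Y + Y) - + 2 * (M + M)) + - + 2
      rat-part = solve-∀
      irr-part : ∀ M Y → (M + Y + + 1) + (M + Y + + 1) ≡ ((M + M) - - (Y + Y)) + + 2
      irr-part = solve-∀

    gap-transpose₁ : ∀ m j → gap m (j ℕ.+ j ℕ.+ 1) ≡ ⊖ √2· gap (ℕ.suc j) m ⊕ two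
    gap-transpose₁ m j = cong₂ ⟨_,_⟩ (rat-part (+ j)) (irr-part (+ m))
      where
      rat-part : ∀ J → - ((J + J + + 1) + (J + J + + 1)) ≡ - (+ 2 * ((+ 1 + J) + (+ 1 + J))) + + 2
      rat-part = solve-∀
      irr-part : ∀ M → M + M ≡ - - (M + M) + 0ℤ
      irr-part = solve-∀

    gap-transpose₀ : ∀ m j → gap m (j ℕ.+ j ℕ.+ 0) ≡ ⊖ √2· gap (ℕ.suc j) m ⊕ ⟨ + 4 , 0ℤ ⟩
    gap-transpose₀ m j = cong₂ ⟨_,_⟩ (rat-part (+ j)) (irr-part (+ m))
      where
      rat-part : ∀ J → - ((J + J + 0ℤ) + (J + J + 0ℤ)) ≡ - (+ 2 * ((+ 1 + J) + (+ 1 + J))) + + 4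
      rat-part = solve-∀
      irr-part : ∀ M → M + M ≡ - - (M + M) + 0ℤ
      irr-part = solve-∀

    gap≢positive-rat : ∀ j y {k q} → gap j y ≢ ⟨ +[1+ k ] , q ⟩
    gap≢positive-rat j y eq = 0≮-+ (y ℕ.+ y) (subst (0ℤ <_) (sym (cong rat eq)) (+<+ ℕ.z<s))

-- Windows of a sequence and desubstitution

open import Data.Nat using (ℕ; zero; suc; _+_; _*_; _∸_; _<_; s≤s)
open import Data.Nat.Properties using (+-suc; +-identityʳ; +-comm; +-assoc; <⇒≤; ≤∧≢⇒<; 0≢1+n; [m+n]∸[m+o]≡n∸o)
open import Data.Nat.Tactic.RingSolver using (solve-∀)
open import Data.Integer using (+_; -_; 0ℤ; +[1+_])
open import Data.List using (List; []; _∷_; _++_; length; lookup; concat; concatMap; map)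
open import Data.List.Properties using (map-++; concat-++; ++-identityʳ)
open import Data.Fin using (fromℕ<)

open Equivalence using (to; from)

private variable
  X : Set

window : (ℕ → X) → ℕ → ℕ → List X
window f s zero    = []
window f s (suc k) = f s ∷ window f (suc s) k

window-++ : ∀ (f : ℕ → X) s k l → window f s (k + l) ≡ window f s k ++ window f (s + k) l
window-++ f s zero    l = cong (λ t → window f t l) (sym (+-identityʳ s))
window-++ f s (suc k) l =
  cong (f s ∷_) (trans (window-++ f (suc s) k l) (cong (λ t → window f (suc s) k ++ window f t l) (sym (+-suc s k))))

lookup-window : ∀ (f : ℕ → X) s k {i} (i<k : i < length (window f s k)) →
                lookup (window f s k) (fromℕ< i<k) ≡ f (s + i)
lookup-window f s (suc k) {zero}  _         = cong f (sym (+-identityʳ s))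
lookup-window f s (suc k) {suc i} (s≤s i<k) = trans (lookup-window f (suc s) k i<k) (cong f (sym (+-suc s i)))

lookup-prefix : ∀ {xs} (f : ℕ → X) n → xs ≡ window f 0 n → ∀ {i} (i<∣xs∣ : i < length xs) →
                lookup xs (fromℕ< i<∣xs∣) ≡ f i
lookup-prefix f n refl i<∣xs∣ = lookup-window f 0 n i<∣xs∣

concatMap-++ : ∀ {Y : Set} (σ : X → List Y) xs ys → concatMap σ (xs ++ ys) ≡ concatMap σ xs ++ concatMap σ ys
concatMap-++ σ xs ys = trans (cong concat (map-++ σ xs ys)) (sym (concat-++ (map σ xs) (map σ ys)))

module _ (σ : X → List X) (f : ℕ → X) (P : ℕ → ℕ)
         (P-zero : P 0 ≡ 0) (P-suc : ∀ n → P (suc n) ≡ P n + length (σ (f n)))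
         (σ-block : ∀ n → window f (P n) (length (σ (f n))) ≡ σ (f n)) where

  concatMap-window : ∀ n → concatMap σ (window f 0 n) ≡ window f 0 (P n)
  concatMap-window zero    = cong (window f 0) (sym P-zero)
  concatMap-window (suc n) = begin
    concatMap σ (window f 0 (suc n))                           ≡⟨ cong (concatMap σ ∘ window f 0) (+-comm n 1) ⟨
    concatMap σ (window f 0 (n + 1))                           ≡⟨ cong (concatMap σ) (window-++ f 0 n 1) ⟩
    concatMap σ (window f 0 n ++ f n ∷ [])                     ≡⟨ concatMap-++ σ (window f 0 n) (f n ∷ []) ⟩
    concatMap σ (window f 0 n) ++ σ (f n) ++ []                ≡⟨ cong₂ _++_ (concatMap-window n) (++-identityʳ (σ (f n))) ⟩
    window f 0 (P n) ++ σ (f n)                                ≡⟨ cong (window f 0 (P n) ++_) (σ-block n) ⟨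
    window f 0 (P n) ++ window f (P n) (length (σ (f n)))      ≡⟨ window-++ f 0 (P n) _ ⟨
    window f 0 (P n + length (σ (f n)))                        ≡⟨ cong (window f 0) (P-suc n) ⟨
    window f 0 (P (suc n))                                     ∎
    where open ≡-Reasoning

-- The orbit of 2{n√2}

twiceFract : ℕ → ℤ[√2]
twiceFract j = gap j (A j)

A-from-gap : ∀ {j y} → gap j y ∈⟨ 0# , two ⟩ → A j ≡ y
A-from-gap (0≺g , g≺2) = isqrt-unique (<⇒≤ (to 0≺gap⇔ 0≺g)) (to gap≺two⇔ g≺2)

twiceFract-≡-gap : ∀ {j y} → gap j y ∈⟨ 0# , two ⟩ → twiceFract j ≡ gap j y
twiceFract-≡-gap {j} g∈ = cong (gap j) (A-from-gap g∈)

twiceFract-∈ : ∀ j → twiceFract (suc j) ∈⟨ 0# , two ⟩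
twiceFract-∈ j = from 0≺gap⇔ A²<2j² , from gap≺two⇔ (<-isqrt-suc-sq (2 * (suc j * suc j)))
  where
  A²<2j² = ≤∧≢⇒< (isqrt-sq≤ _) (λ A²≡2j² → 0≢1+n (sym (√2-irrational (A (suc j)) (suc j) A²≡2j²)))

B₁ B₂ B₃ B₄ √2 : ℤ[√2]
B₁ = ⟨ + 6 , - + 4 ⟩
B₂ = ⟨ + 2 , - + 1 ⟩
B₃ = ⟨ + 4 , - + 2 ⟩
B₄ = ⟨ + 6 , - + 3 ⟩
√2 = ⟨ 0ℤ , + 1 ⟩

-- From j to j + 1, twiceFract advances by 2√2 modulo 2: by 2√2 − 2 below B₃ = 4 − 2√2,
-- by 2√2 − 4 above it.
step₁ step₂ : ℤ[√2]
step₁ = ⟨ - + 2 , + 2 ⟩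
step₂ = ⟨ - + 4 , + 2 ⟩

A-suc-small : ∀ {j} → twiceFract (suc j) ≺ B₃ → A (suc (suc j)) ≡ A (suc j) + 1
A-suc-small {j} x≺B₃ = A-from-gap (subst (_∈⟨ 0# , two ⟩) (sym (gap-suc (suc j) (A (suc j)) 1))
                                         (widen (⊕-∈ step₁ (lower (twiceFract-∈ j) , x≺B₃))))

A-suc-large : ∀ {j} → B₃ ≺ twiceFract (suc j) → A (suc (suc j)) ≡ A (suc j) + 2
A-suc-large {j} B₃≺x = A-from-gap (subst (_∈⟨ 0# , two ⟩) (sym (gap-suc (suc j) (A (suc j)) 2))
                                         (widen (⊕-∈ step₂ (B₃≺x , upper (twiceFract-∈ j)))))

twiceFract-suc-small : ∀ {j} → twiceFract (suc j) ≺ B₃ → twiceFract (suc (suc j)) ≡ twiceFract (suc j) ⊕ step₁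
twiceFract-suc-small {j} x≺B₃ = trans (cong (gap (suc (suc j))) (A-suc-small x≺B₃)) (gap-suc (suc j) (A (suc j)) 1)

twiceFract-suc-large : ∀ {j} → B₃ ≺ twiceFract (suc j) → twiceFract (suc (suc j)) ≡ twiceFract (suc j) ⊕ step₂
twiceFract-suc-large {j} B₃≺x = trans (cong (gap (suc (suc j))) (A-suc-large B₃≺x)) (gap-suc (suc j) (A (suc j)) 2)

rotate-small : ∀ {j lo hi} → twiceFract (suc j) ∈⟨ lo , hi ⟩ → {_ : True (hi ≼? B₃)} →
               twiceFract (suc (suc j)) ∈⟨ lo ⊕ step₁ , hi ⊕ step₁ ⟩
rotate-small x∈ {hi≼B₃} = subst (_∈⟨ _ , _ ⟩) (sym (twiceFract-suc-small (below x∈ {hi≼B₃}))) (⊕-∈ step₁ x∈)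

rotate-large : ∀ {j lo hi} → twiceFract (suc j) ∈⟨ lo , hi ⟩ → {_ : True (B₃ ≼? lo)} →
               twiceFract (suc (suc j)) ∈⟨ lo ⊕ step₂ , hi ⊕ step₂ ⟩
rotate-large x∈ {B₃≼lo} = subst (_∈⟨ _ , _ ⟩) (sym (twiceFract-suc-large (above x∈ {B₃≼lo}))) (⊕-∈ step₂ x∈)

AA-below : ∀ {j lo hi} → twiceFract (suc j) ∈⟨ lo , hi ⟩ → {_ : True (hi ≼? √2)} → A (A (suc j)) ≡ j + j + 1
AA-below {j} x∈ {hi≼√2} = A-from-gap (subst (_∈⟨ 0# , two ⟩) (sym (gap-transpose₁ (A (suc j)) j))
                                     (⊕-∈ two (⊖-∈ (√2·-∈ (lower (twiceFract-∈ j) , below x∈ {hi≼√2})))))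

AA-above : ∀ {j lo hi} → twiceFract (suc j) ∈⟨ lo , hi ⟩ → {_ : True (√2 ≼? lo)} → A (A (suc j)) ≡ j + j + 0
AA-above {j} x∈ {√2≼lo} = A-from-gap (subst (_∈⟨ 0# , two ⟩) (sym (gap-transpose₀ (A (suc j)) j))
                                     (widen (⊕-∈ ⟨ + 4 , 0ℤ ⟩ (⊖-∈ (√2·-∈ (above x∈ {√2≼lo} , upper (twiceFract-∈ j)))))))

ΔAA-via : ∀ j {s t} → A (A (suc (suc j))) ≡ suc j + suc j + s → A (A (suc j)) ≡ j + j + t → ΔAA (suc j) ≡ 2 + s ∸ t
ΔAA-via j {s} {t} AA₂ AA₁ = begin
  A (A (suc (suc j))) ∸ A (A (suc j))    ≡⟨ cong₂ _∸_ AA₂ AA₁ ⟩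
  (suc j + suc j + s) ∸ (j + j + t)      ≡⟨ cong (_∸ (j + j + t)) (regroup j s) ⟩
  (j + j + (2 + s)) ∸ (j + j + t)        ≡⟨ [m+n]∸[m+o]≡n∸o (j + j) (2 + s) t ⟩
  2 + s ∸ t                              ∎
  where
  open ≡-Reasoning
  regroup : ∀ j s → suc j + suc j + s ≡ j + j + (2 + s)
  regroup = solve-∀

-- The coding and its θ-blocks

data Region : Set where
  R₁ R₂ R₃ R₄ R₅ : Region

lowerCut upperCut : Region → ℤ[√2]
lowerCut R₁ = 0#
lowerCut R₂ = B₁
lowerCut R₃ = B₂
lowerCut R₄ = B₃
lowerCut R₅ = B₄
upperCut R₁ = B₁
upperCut R₂ = B₂
upperCut R₃ = B₃
upperCut R₄ = B₄
upperCut R₅ = two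

_∈ᴿ_ : ℤ[√2] → Region → Set
x ∈ᴿ r = x ∈⟨ lowerCut r , upperCut r ⟩

region : ℤ[√2] → Region
region x = if does (x ≺? B₁) then R₁ else if does (x ≺? B₂) then R₂ else
           if does (x ≺? B₃) then R₃ else if does (x ≺? B₄) then R₄ else R₅

letter : Region → Letter
letter R₁ = a
letter R₂ = b
letter R₃ = d
letter R₄ = c
letter R₅ = a

letterAt : ℕ → Letter
letterAt n = letter (region (twiceFract n))

letterAt-0 : letterAt 0 ≡ a
letterAt-0 = cong (letter ∘ region) (gap-def 0 0)

letterAt-1 : letterAt 1 ≡ d
letterAt-1 = cong (letter ∘ region) (gap-def 1 1)

letterAt-2 : letterAt 2 ≡ c
letterAt-2 = cong (letter ∘ region) (gap-def 2 2)

region-≡ : ∀ {x} r → x ∈ᴿ r → region x ≡ r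
region-≡ {x} R₁ x∈ rewrite dec-true (x ≺? B₁) (below x∈) = refl
region-≡ {x} R₂ x∈ rewrite dec-false (x ≺? B₁) (not-below x∈) | dec-true (x ≺? B₂) (below x∈) = refl
region-≡ {x} R₃ x∈ rewrite dec-false (x ≺? B₁) (not-below x∈) | dec-false (x ≺? B₂) (not-below x∈)
                         | dec-true (x ≺? B₃) (below x∈) = refl
region-≡ {x} R₄ x∈ rewrite dec-false (x ≺? B₁) (not-below x∈) | dec-false (x ≺? B₂) (not-below x∈)
                         | dec-false (x ≺? B₃) (not-below x∈) | dec-true (x ≺? B₄) (below x∈) = refl
region-≡ {x} R₅ x∈ rewrite dec-false (x ≺? B₁) (not-below x∈) | dec-false (x ≺? B₂) (not-below x∈)
                         | dec-false (x ≺? B₃) (not-below x∈) | dec-false (x ≺? B₄) (not-below x∈) = refl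

letterAt-∈ : ∀ r {k lo hi} → twiceFract k ∈⟨ lo , hi ⟩ → {_ : True (lowerCut r ≼? lo)} → {_ : True (hi ≼? upperCut r)} →
             letterAt k ≡ letter r
letterAt-∈ r x∈ {lo≼} {≼hi} = cong letter (region-≡ r (widen x∈ {lo≼} {≼hi}))

classify : ∀ {x} → x ∈⟨ 0# , two ⟩ → (∀ {k q} → x ≢ ⟨ +[1+ k ] , q ⟩) → Σ Region (x ∈ᴿ_)
classify {x} x∈ x≢cut with x ≺? B₁
... | yes x≺B₁ = R₁ , (lower x∈ , x≺B₁)
... | no x⊀B₁ with x ≺? B₂
...   | yes x≺B₂ = R₂ , (≺-split x≢cut x⊀B₁ , x≺B₂)
...   | no x⊀B₂ with x ≺? B₃
...     | yes x≺B₃ = R₃ , (≺-split x≢cut x⊀B₂ , x≺B₃)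
...     | no x⊀B₃ with x ≺? B₄
...       | yes x≺B₄ = R₄ , (≺-split x≢cut x⊀B₃ , x≺B₄)
...       | no x⊀B₄ = R₅ , (≺-split x≢cut x⊀B₄ , upper x∈)

twiceFract-∈-region : ∀ n → twiceFract (suc n) ∈ᴿ region (twiceFract (suc n))
twiceFract-∈-region n with classify (twiceFract-∈ n) (gap≢positive-rat (suc n) (A (suc n)))
... | r , x∈r = subst (twiceFract (suc n) ∈ᴿ_) (sym (region-≡ r x∈r)) x∈r

λ'-region : ∀ n r → twiceFract (suc n) ∈ᴿ r → λ' (letter r) ≡ ΔAA (suc (suc n))
λ'-region n R₁ x∈ = sym (ΔAA-via (suc n) (AA-above (rotate-small (rotate-small x∈))) (AA-below (rotate-small x∈)))
λ'-region n R₂ x∈ = sym (ΔAA-via (suc n) (AA-below (rotate-large (rotate-small x∈))) (AA-below (rotate-small x∈)))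
λ'-region n R₃ x∈ = sym (ΔAA-via (suc n) (AA-below (rotate-large (rotate-small x∈))) (AA-above (rotate-small x∈)))
λ'-region n R₄ x∈ = sym (ΔAA-via (suc n) (AA-below (rotate-small (rotate-large x∈))) (AA-below (rotate-large x∈)))
λ'-region n R₅ x∈ = sym (ΔAA-via (suc n) (AA-above (rotate-small (rotate-large x∈))) (AA-below (rotate-large x∈)))

λ'-letterAt : ∀ k → λ' (letterAt k) ≡ ΔAA (suc k)
λ'-letterAt zero    = cong λ' letterAt-0
λ'-letterAt (suc n) = λ'-region n (region (twiceFract (suc n))) (twiceFract-∈-region n)

carry : ℤ[√2] → ℕ
carry x = if does (B₂ ≺? x) then 1 else 0

carry-low : ∀ {x} → x ≺ B₂ → carry x ≡ 0
carry-low {x} x≺B₂ rewrite dec-false (B₂ ≺? x) (≺-asym x≺B₂) = refl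

carry-high : ∀ {x} → B₂ ≺ x → carry x ≡ 1
carry-high {x} B₂≺x rewrite dec-true (B₂ ≺? x) B₂≺x = refl

-- θ(letterAt n) occupies the positions from blockStart n on
blockStart : ℕ → ℕ
blockStart n = n + A n + carry (twiceFract n)

blockStart-0 : blockStart 0 ≡ 0
blockStart-0 = cong carry (gap-def 0 0)

blockStart-1 : blockStart 1 ≡ 3
blockStart-1 = cong (λ x → 2 + carry x) (gap-def 1 1)

-- The self-similarity behind θ: at position n + A n + carry, twiceFract is the image of
-- x = twiceFract n under the affine map x ↦ (1 − √2)x + c, with c = 2 or 2√2 − 2.
renormalise₀ : ∀ {n lo hi} → twiceFract (suc n) ∈⟨ lo , hi ⟩ → {_ : True (hi ≼? B₂)} →
               twiceFract (suc n + A (suc n) + 0) ∈⟨ ρ· hi ⊕ two , ρ· lo ⊕ two ⟩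
renormalise₀ {n} x∈ {hi≼B₂} = subst (_∈⟨ _ , _ ⟩) (sym twiceFract≡) (⊕-∈ two (ρ·-∈ x∈))
  where
  gap≡ = gap-renormalise₀ n (A (suc n))
  twiceFract≡ : twiceFract (suc n + A (suc n) + 0) ≡ ρ· twiceFract (suc n) ⊕ two
  twiceFract≡ = trans (twiceFract-≡-gap (subst (_∈⟨ 0# , two ⟩) (sym gap≡)
                        (widen (⊕-∈ two (ρ·-∈ (lower (twiceFract-∈ n) , below x∈ {hi≼B₂})))))) gap≡

renormalise₁ : ∀ {n lo hi} → twiceFract (suc n) ∈⟨ lo , hi ⟩ → {_ : True (B₂ ≼? lo)} →
               twiceFract (suc n + A (suc n) + 1) ∈⟨ ρ· hi ⊕ step₁ , ρ· lo ⊕ step₁ ⟩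
renormalise₁ {n} x∈ {B₂≼lo} = subst (_∈⟨ _ , _ ⟩) (sym twiceFract≡) (⊕-∈ step₁ (ρ·-∈ x∈))
  where
  gap≡ = gap-renormalise₁ (suc n) (A (suc n))
  twiceFract≡ : twiceFract (suc n + A (suc n) + 1) ≡ ρ· twiceFract (suc n) ⊕ step₁
  twiceFract≡ = trans (twiceFract-≡-gap (subst (_∈⟨ 0# , two ⟩) (sym gap≡)
                        (widen (⊕-∈ step₁ (ρ·-∈ (above x∈ {B₂≼lo} , upper (twiceFract-∈ n))))))) gap≡

window-at : ∀ n {k} ℓ → carry (twiceFract (suc n)) ≡ k →
            window letterAt (blockStart (suc n)) ℓ ≡ window letterAt (suc n + A (suc n) + k) ℓ
window-at n ℓ carry≡ = cong (λ k → window letterAt (suc n + A (suc n) + k) ℓ) carry≡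

window-region : ∀ n r → twiceFract (suc n) ∈ᴿ r →
                window letterAt (blockStart (suc n)) (length (θ (letter r))) ≡ θ (letter r)
window-region n R₁ x∈ = trans (window-at n 3 (carry-low (below x∈)))
  (cong₂ _∷_ (letterAt-∈ R₅ y₀) (cong₂ _∷_ (letterAt-∈ R₃ y₁) (cong₂ _∷_ (letterAt-∈ R₄ (rotate-small y₁)) refl)))
  where
  y₀ = renormalise₀ x∈
  y₁ = rotate-large y₀
window-region n R₂ x∈ = trans (window-at n 3 (carry-low (below x∈)))
  (cong₂ _∷_ (letterAt-∈ R₅ y₀) (cong₂ _∷_ (letterAt-∈ R₃ y₁) (cong₂ _∷_ (letterAt-∈ R₄ (rotate-small y₁)) refl)))
  where
  y₀ = renormalise₀ x∈
  y₁ = rotate-large y₀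
window-region n R₃ x∈ = trans (window-at n 2 (carry-high (above x∈)))
  (cong₂ _∷_ (letterAt-∈ R₂ y₀) (cong₂ _∷_ (letterAt-∈ R₄ (rotate-small y₀)) refl))
  where
  y₀ = renormalise₁ x∈
window-region n R₄ x∈ = trans (window-at n 2 (carry-high (above x∈)))
  (cong₂ _∷_ (letterAt-∈ R₁ y₀) (cong₂ _∷_ (letterAt-∈ R₃ (rotate-small y₀)) refl))
  where
  y₀ = renormalise₁ x∈
window-region n R₅ x∈ = trans (window-at n 3 (carry-high (above x∈)))
  (cong₂ _∷_ (letterAt-∈ R₁ y₀) (cong₂ _∷_ (letterAt-∈ R₃ y₁) (cong₂ _∷_ (letterAt-∈ R₄ (rotate-small y₁)) refl)))
  where
  y₀ = renormalise₁ x∈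
  y₁ = rotate-small y₀

blockStart-step : ∀ n δ k k′ l → A (suc (suc n)) ≡ A (suc n) + δ →
                  carry (twiceFract (suc n)) ≡ k → carry (twiceFract (suc (suc n))) ≡ k′ → k + l ≡ 1 + δ + k′ →
                  blockStart (suc (suc n)) ≡ blockStart (suc n) + l
blockStart-step n δ k k′ l A≡ carry≡ carry′≡ k+l≡ = begin
  suc (suc n) + A (suc (suc n)) + carry (twiceFract (suc (suc n)))    ≡⟨ cong₂ (λ m k → suc (suc n) + m + k) A≡ carry′≡ ⟩
  suc (suc n) + (A (suc n) + δ) + k′                                  ≡⟨ regroup n (A (suc n)) δ k′ ⟩
  suc n + A (suc n) + (1 + δ + k′)                                    ≡⟨ cong (_+_ (suc n + A (suc n))) k+l≡ ⟨
  suc n + A (suc n) + (k + l)                                         ≡⟨ +-assoc (suc n + A (suc n)) k l ⟨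
  suc n + A (suc n) + k + l                                           ≡⟨ cong (λ k → suc n + A (suc n) + k + l) carry≡ ⟨
  blockStart (suc n) + l                                              ∎
  where
  open ≡-Reasoning
  regroup : ∀ n m δ k′ → suc (suc n) + (m + δ) + k′ ≡ suc n + m + (1 + δ + k′)
  regroup = solve-∀

blockStart-suc-region : ∀ n r → twiceFract (suc n) ∈ᴿ r →
                        blockStart (suc (suc n)) ≡ blockStart (suc n) + length (θ (letter r))
blockStart-suc-region n R₁ x∈ =
  blockStart-step n 1 0 1 3 (A-suc-small (below x∈)) (carry-low (below x∈)) (carry-high (above (rotate-small x∈))) refl
blockStart-suc-region n R₂ x∈ =
  blockStart-step n 1 0 1 3 (A-suc-small (below x∈)) (carry-low (below x∈)) (carry-high (above (rotate-small x∈))) refl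
blockStart-suc-region n R₃ x∈ =
  blockStart-step n 1 1 1 2 (A-suc-small (below x∈)) (carry-high (above x∈)) (carry-high (above (rotate-small x∈))) refl
blockStart-suc-region n R₄ x∈ =
  blockStart-step n 2 1 0 2 (A-suc-large (above x∈)) (carry-high (above x∈)) (carry-low (below (rotate-large x∈))) refl
blockStart-suc-region n R₅ x∈ =
  blockStart-step n 2 1 1 3 (A-suc-large (above x∈)) (carry-high (above x∈)) (carry-high (above (rotate-large x∈))) refl

blockStart-suc : ∀ n → blockStart (suc n) ≡ blockStart n + length (θ (letterAt n))
blockStart-suc zero    = begin
  blockStart 1                                ≡⟨ blockStart-1 ⟩
  3                                           ≡⟨ cong₂ (λ s ℓ → s + length (θ ℓ)) blockStart-0 letterAt-0 ⟨
  blockStart 0 + length (θ (letterAt 0))      ∎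
  where open ≡-Reasoning
blockStart-suc (suc n) = blockStart-suc-region n (region (twiceFract (suc n))) (twiceFract-∈-region n)

θ-block : ∀ n → window letterAt (blockStart n) (length (θ (letterAt n))) ≡ θ (letterAt n)
θ-block zero    = begin
  window letterAt (blockStart 0) (length (θ (letterAt 0)))
    ≡⟨ cong₂ (λ s ℓ → window letterAt s (length (θ ℓ))) blockStart-0 letterAt-0 ⟩
  letterAt 0 ∷ letterAt 1 ∷ letterAt 2 ∷ []
    ≡⟨ cong₂ _∷_ letterAt-0 (cong₂ _∷_ letterAt-1 (cong₂ _∷_ letterAt-2 refl)) ⟩
  θ a
    ≡⟨ cong θ letterAt-0 ⟨
  θ (letterAt 0)
    ∎
  where open ≡-Reasoning
θ-block (suc n) = window-region n (region (twiceFract (suc n))) (twiceFract-∈-region n)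

prefixLength : ℕ → ℕ
prefixLength zero    = 1
prefixLength (suc m) = blockStart (prefixLength m)

θ^-window : ∀ m → θ^ m ≡ window letterAt 0 (prefixLength m)
θ^-window zero    = cong (_∷ []) (sym letterAt-0)
θ^-window (suc m) = trans (cong θ* (θ^-window m))
                          (concatMap-window θ letterAt blockStart blockStart-0 blockStart-suc θ-block (prefixLength m))

corollary2 : ∀ (m k : ℕ) (h : k < length (θ^ m)) →
    λ' (lookup (θ^ m) (fromℕ< h)) ≡ ΔAA (suc k)
corollary2 m k h = begin
  λ' (lookup (θ^ m) (fromℕ< h))   ≡⟨ cong λ' (lookup-prefix letterAt (prefixLength m) (θ^-window m) h) ⟩
  λ' (letterAt k)                 ≡⟨ λ'-letterAt k ⟩
  ΔAA (suc k)                     ∎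
  where open ≡-Reasoning
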